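{- Let $G,H$ be connected graphs, and let $(g,h),(g',h'),(g'',h'')$ be three (distinct) vertices of $G\Box H$. Let $S_G=\{g,g',g''\}$, $S_H=\{h,h',h''\}$ (as multisets) and $S=\{(g,h),(g',h'),(g'',h'')\}$. Then $d_{G\Box H}(S)=d_G(S_G)+d_H(S_H)$.
   Context: For a graph $F$ and a set (or multiset) $S$ of vertices of $F$, the Steiner distance $d_F(S)$ is the minimum number of edges of a connected subgraph of $F$ whose vertex set contains every vertex of $S$. The Cartesian product $G\Box H$ has vertex set $V(G)\times V(H)$, with $(g,h)\sim(g',h')$ iff either $g=g'$ and $hh'\in E(H)$, or $h=h'$ and $gg'\in E(G)$. -}

module Defs where

open import Data.Nat using (ℕ; _≤_; _+_)
open import Data.Fin using (Fin)
open import Data.Product using (Σ; _×_; _,_; proj₁; proj₂)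
open import Data.Sum using (_⊎_)
open import Data.List using (List; []; _∷_; length)
open import Data.List.Relation.Unary.All using (All)
open import Data.List.Relation.Unary.AllPairs using (AllPairs)
open import Data.List.Membership.Propositional using (_∈_)
open import Relation.Nullary using (¬_)
open import Relation.Binary.PropositionalEquality using (_≡_)

record Graph (V : Set) : Set₁ where
  field
    Adj     : V → V → Set
    symAdj  : ∀ {x y} → Adj x y → Adj y x
    irrefl  : ∀ {x} → ¬ Adj x x
open Graph public

data GWalk {V : Set} (G : Graph V) : V → V → Set where
  nil  : ∀ {x} → GWalk G x x
  cons : ∀ {x y z} → Adj G x y → GWalk G y z → GWalk G x z

Connected : {V : Set} → Graph V → Set
Connected G = ∀ x y → GWalk G x y

_□_ : {V W : Set} → Graph V → Graph W → Graph (V × W)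
_□_ {V} {W} G H = record
  { Adj = A
  ; symAdj = sy
  ; irrefl = ir
  }
  where
    A : V × W → V × W → Set
    A (g , h) (g' , h') = (g ≡ g' × Adj H h h') ⊎ (h ≡ h' × Adj G g g')
    sy : ∀ {x y} → A x y → A y x
    sy (Data.Sum.inj₁ (Relation.Binary.PropositionalEquality.refl , a)) =
      Data.Sum.inj₁ (Relation.Binary.PropositionalEquality.refl , symAdj H a)
    sy (Data.Sum.inj₂ (Relation.Binary.PropositionalEquality.refl , a)) =
      Data.Sum.inj₂ (Relation.Binary.PropositionalEquality.refl , symAdj G a)
    ir : ∀ {x} → ¬ A x x
    ir (Data.Sum.inj₁ (_ , a)) = irrefl H a
    ir (Data.Sum.inj₂ (_ , a)) = irrefl G a

SameEdge : {V : Set} → V × V → V × V → Set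
SameEdge (u , v) (u' , v') = (u ≡ u' × v ≡ v') ⊎ (u ≡ v' × v ≡ u')

data EWalk {V : Set} (es : List (V × V)) : V → V → Set where
  nil  : ∀ {x} → EWalk es x x
  cons : ∀ {x y z} → ((x , y) ∈ es ⊎ (y , x) ∈ es) → EWalk es y z → EWalk es x z

record ConnSubgraph {V : Set} (G : Graph V) : Set₁ where
  field
    Vs       : V → Set
    edges    : List (V × V)
    edgesAdj : All (λ e → Adj G (proj₁ e) (proj₂ e)) edges
    edgesIn  : All (λ e → Vs (proj₁ e) × Vs (proj₂ e)) edges
    distinct : AllPairs (λ e e' → ¬ SameEdge e e') edges
    conn     : ∀ x y → Vs x → Vs y → EWalk edges x y
open ConnSubgraph public

size : {V : Set} {G : Graph V} → ConnSubgraph G → ℕ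
size F = length (edges F)

Contains : {V : Set} {G : Graph V} → ConnSubgraph G → List V → Set
Contains F S = All (Vs F) S

SteinerDist : {V : Set} → Graph V → List V → ℕ → Set₁
SteinerDist G S k =
  Σ (ConnSubgraph G) (λ F → Contains F S × size F ≡ k)
  × (∀ (F : ConnSubgraph G) → Contains F S → k ≤ size F)

-- A connected subgraph F of G □ H containing S has two
-- kinds of edges: G-edges (H-coordinate fixed) and H-edges.  Projecting
-- the G-edges (made distinct) gives a connected subgraph of G containing
-- S_G, and likewise for H; so d_G(S_G) + d_H(S_H) ≤ |E(F)|.
--
-- In a connected subgraph with edge list E containing
-- a, b, c there is a centre x with walks to a, b, c of total length at
-- most |E| (the tripod lemma, from a path a–b and the first point where
-- a path from c meets it).  With tripod centres x in G and y in H, the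
-- three "corner" walks (x , y) → (a , y) → (a , a') use each tripod walk
-- once, and the union of walks out of a common hub is a connected
-- subgraph with at most their total number of edges.
module Submission where

open import Defs
open import Data.Nat using (ℕ; zero; suc; _+_; _≤_; z≤n; s≤s)
open import Data.Nat.Properties using (≤-trans; ≤-antisym; ≤-reflexive; +-mono-≤; +-suc; +-comm; module ≤-Reasoning)
open import Data.Fin using (Fin)
import Data.Fin.Properties as Fin
open import Data.Product using (Σ; _×_; _,_; proj₁; proj₂)
open import Data.Product.Properties using (≡-dec)
import Data.Product as Product
open import Data.Nat.Solver using (module +-*-Solver)
open import Data.Sum using (_⊎_; inj₁; inj₂)
import Data.Sum as Sum
open import Data.List using (List; []; _∷_; length; _++_; map; deduplicate)
open import Data.List.Properties using (length-++; length-removeAt′; length-deduplicate)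
open import Data.List.Relation.Unary.All using (All; []; _∷_)
import Data.List.Relation.Unary.All as All
import Data.List.Relation.Unary.All.Properties as All
open import Data.List.Relation.Unary.Any using (Any; here; there; index; _─_)
import Data.List.Relation.Unary.Any as Any
import Data.List.Relation.Unary.Any.Properties as Any
open import Data.List.Relation.Unary.AllPairs using (AllPairs; []; _∷_)
import Data.List.Relation.Unary.AllPairs.Properties as AllPairs
open import Data.List.Relation.Unary.Unique.Propositional using (Unique)
open import Data.List.Relation.Unary.Unique.DecSetoid.Properties using (deduplicate-!)
open import Data.List.Membership.Propositional using (_∈_; _∉_)
import Data.List.Membership.DecPropositional as DecMembership
open import Data.List.Relation.Binary.Subset.Propositional using (_⊆_)
open import Relation.Nullary using (¬_; yes; no)
open import Relation.Nullary.Decidable using (_×-dec_; _⊎-dec_)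
open import Relation.Binary.Bundles using (DecSetoid)
open import Relation.Binary.Definitions using (DecidableEquality; Decidable)
open import Relation.Binary.PropositionalEquality
open import Data.Empty using (⊥-elim)
open import Level using (0ℓ)

module Edges {V : Set} where

  sameEdge-refl : (e : V × V) → SameEdge e e
  sameEdge-refl _ = inj₁ (refl , refl)

  sameEdge-sym : {e f : V × V} → SameEdge e f → SameEdge f e
  sameEdge-sym (inj₁ (refl , refl)) = inj₁ (refl , refl)
  sameEdge-sym (inj₂ (refl , refl)) = inj₂ (refl , refl)

  sameEdge-trans : {e f k : V × V} → SameEdge e f → SameEdge f k → SameEdge e k
  sameEdge-trans (inj₁ (refl , refl)) q                    = q
  sameEdge-trans (inj₂ (refl , refl)) (inj₁ (refl , refl)) = inj₂ (refl , refl)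
  sameEdge-trans (inj₂ (refl , refl)) (inj₂ (refl , refl)) = inj₁ (refl , refl)

  _∈ᴱ_ : V × V → List (V × V) → Set
  e ∈ᴱ E = Any (SameEdge e) E

  Distinct : List (V × V) → Set
  Distinct = AllPairs (λ e f → ¬ SameEdge e f)

  ∈ᴱ-─ : ∀ {E s t} (t∈E : t ∈ᴱ E) → s ∈ᴱ E → ¬ SameEdge t s → s ∈ᴱ (E ─ t∈E)
  ∈ᴱ-─ (here t≈e)  (here s≈e)  t≉s = ⊥-elim (t≉s (sameEdge-trans t≈e (sameEdge-sym s≈e)))
  ∈ᴱ-─ (here _)    (there s∈E) _   = s∈E
  ∈ᴱ-─ (there _)   (here s≈e)  _   = here s≈e
  ∈ᴱ-─ (there t∈E) (there s∈E) t≉s = there (∈ᴱ-─ t∈E s∈E t≉s)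

  -- Pigeonhole: a list of distinct edges, all occurring in E, is no longer than E.
  distinct-length : ∀ {T E} → Distinct T → All (_∈ᴱ E) T → length T ≤ length E
  distinct-length {[]}    _                 _              = z≤n
  distinct-length {t ∷ T} {E} (t≉T ∷ T-distinct) (t∈E ∷ T⊆E) = begin
    suc (length T)          ≤⟨ s≤s (distinct-length T-distinct T⊆E─t) ⟩
    suc (length (E ─ t∈E))  ≡⟨ sym (length-removeAt′ E (index t∈E)) ⟩
    length E                ∎
    where
      open ≤-Reasoning
      T⊆E─t : All (_∈ᴱ (E ─ t∈E)) T
      T⊆E─t = All.zipWith (λ (t≉s , s∈E) → ∈ᴱ-─ t∈E s∈E t≉s) (t≉T , T⊆E)

  Step : List (V × V) → V → V → Set
  Step E x y = (x , y) ∈ E ⊎ (y , x) ∈ E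

  step⇒∈ᴱ : ∀ {E x y} → Step E x y → (x , y) ∈ᴱ E
  step⇒∈ᴱ (inj₁ xy∈E) = Any.map (λ { refl → sameEdge-refl _ }) xy∈E
  step⇒∈ᴱ (inj₂ yx∈E) = Any.map (λ { refl → inj₂ (refl , refl) }) yx∈E

  ∈ᴱ⇒step : ∀ {E x y} → (x , y) ∈ᴱ E → Step E x y
  ∈ᴱ⇒step (here (inj₁ (refl , refl))) = inj₁ (here refl)
  ∈ᴱ⇒step (here (inj₂ (refl , refl))) = inj₂ (here refl)
  ∈ᴱ⇒step (there xy∈E)                = Sum.map there there (∈ᴱ⇒step xy∈E)

module Walks {V : Set} where
  open Edges {V}

  walk-mono : ∀ {E F a b} → (∀ {e} → e ∈ᴱ E → e ∈ᴱ F) → EWalk E a b → EWalk F a b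
  walk-mono E⊆F nil        = nil
  walk-mono E⊆F (cons s w) = cons (∈ᴱ⇒step (E⊆F (step⇒∈ᴱ s))) (walk-mono E⊆F w)

  edgesW : ∀ {E a b} → EWalk {V} E a b → List (V × V)
  edgesW nil                = []
  edgesW (cons {x} {y} _ w) = (x , y) ∷ edgesW w

  vertsW : ∀ {E a b} → EWalk {V} E a b → List V
  vertsW {a = a} nil    = a ∷ []
  vertsW (cons {x} _ w) = x ∷ vertsW w

  len : ∀ {E a b} → EWalk {V} E a b → ℕ
  len nil        = zero
  len (cons _ w) = suc (len w)

  length-edgesW : ∀ {E a b} (w : EWalk {V} E a b) → length (edgesW w) ≡ len w
  length-edgesW nil        = refl
  length-edgesW (cons _ w) = cong suc (length-edgesW w)

  edgesW-∈ᴱ : ∀ {E a b} (w : EWalk {V} E a b) → All (_∈ᴱ E) (edgesW w)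
  edgesW-∈ᴱ nil        = []
  edgesW-∈ᴱ (cons s w) = step⇒∈ᴱ s ∷ edgesW-∈ᴱ w

  start∈vertsW : ∀ {E a b} (w : EWalk {V} E a b) → a ∈ vertsW w
  start∈vertsW nil        = here refl
  start∈vertsW (cons _ _) = here refl

  edgesW-ends : ∀ {E a b} (w : EWalk {V} E a b) →
    All (λ e → proj₁ e ∈ vertsW w × proj₂ e ∈ vertsW w) (edgesW w)
  edgesW-ends nil        = []
  edgesW-ends (cons _ w) =
    (here refl , there (start∈vertsW w)) ∷ All.map (Product.map there there) (edgesW-ends w)

  _++w_ : ∀ {E a b c} → EWalk {V} E a b → EWalk E b c → EWalk E a c
  nil      ++w v = v
  cons s w ++w v = cons s (w ++w v)

  len-++w : ∀ {E a b c} (w : EWalk {V} E a b) (v : EWalk E b c) → len (w ++w v) ≡ len w + len v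
  len-++w nil        v = refl
  len-++w (cons _ w) v = cong suc (len-++w w v)

  reverseW : ∀ {E a b} → EWalk {V} E a b → EWalk E b a
  reverseW nil        = nil
  reverseW (cons s w) = reverseW w ++w cons (Sum.swap s) nil

  len-reverseW : ∀ {E a b} (w : EWalk {V} E a b) → len (reverseW w) ≡ len w
  len-reverseW nil        = refl
  len-reverseW (cons s w) = begin
    len (reverseW w ++w cons (Sum.swap s) nil) ≡⟨ len-++w (reverseW w) _ ⟩
    len (reverseW w) + 1                       ≡⟨ cong (_+ 1) (len-reverseW w) ⟩
    len w + 1                                  ≡⟨ +-comm (len w) 1 ⟩
    suc (len w)                                ∎
    where open ≡-Reasoning

module Dedup {V : Set} (_≟_ : DecidableEquality V) where
  open Edges {V}
  open Walks {V}

  sameEdge? : Decidable (SameEdge {V})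
  sameEdge? (u , v) (u' , v') = ((u ≟ u') ×-dec (v ≟ v')) ⊎-dec ((u ≟ v') ×-dec (v ≟ u'))

  edgeDecSetoid : DecSetoid 0ℓ 0ℓ
  edgeDecSetoid = record
    { Carrier = V × V
    ; _≈_ = SameEdge
    ; isDecEquivalence = record
      { isEquivalence = record { refl = sameEdge-refl _ ; sym = sameEdge-sym ; trans = sameEdge-trans }
      ; _≟_ = sameEdge?
      }
    }

  dedup : List (V × V) → List (V × V)
  dedup = deduplicate sameEdge?

  dedup-distinct : ∀ E → Distinct (dedup E)
  dedup-distinct = deduplicate-! edgeDecSetoid

  dedup-length : ∀ E → length (dedup E) ≤ length E
  dedup-length = length-deduplicate sameEdge?

  dedup-All : ∀ {P : V × V → Set} {E} → All P E → All P (dedup E)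
  dedup-All = All.deduplicate⁺ sameEdge?

  dedup-walk : ∀ {E a b} → EWalk E a b → EWalk (dedup E) a b
  dedup-walk = walk-mono (Any.deduplicate⁺ sameEdge? (λ f≈e t≈f → sameEdge-trans t≈f (sameEdge-sym f≈e)))

module Paths {V : Set} (_≟_ : DecidableEquality V) where
  open Edges {V}
  open Walks {V}
  open DecMembership _≟_ using (_∈?_)

  leaving≉inside : ∀ {Ps : List V} (e f : V × V) → proj₁ e ∉ Ps →
    proj₁ f ∈ Ps × proj₂ f ∈ Ps → ¬ SameEdge e f
  leaving≉inside _ _ e₁∉Ps (f₁∈Ps , _) (inj₁ (refl , _)) = e₁∉Ps f₁∈Ps
  leaving≉inside _ _ e₁∉Ps (_ , f₂∈Ps) (inj₂ (refl , _)) = e₁∉Ps f₂∈Ps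

  path-distinct : ∀ {E a b} (w : EWalk E a b) → Unique (vertsW w) → Distinct (edgesW w)
  path-distinct nil        _              = []
  path-distinct (cons {x} {y} _ w) (x∉w ∷ w-path) =
    All.map (λ {f} → leaving≉inside (x , y) f (λ x∈w → All.lookup x∉w x∈w refl)) (edgesW-ends w)
    ∷ path-distinct w w-path

  pathSuffix : ∀ {E a b x} (w : EWalk E a b) → Unique (vertsW w) → x ∈ vertsW w →
    Σ (EWalk E x b) (λ w' → Unique (vertsW w'))
  pathSuffix nil        w-path (here refl) = nil , w-path
  pathSuffix (cons s w) w-path (here refl) = cons s w , w-path
  pathSuffix (cons _ w) (_ ∷ w-path) (there x∈w) = pathSuffix w w-path x∈w

  toPath : ∀ {E a b} → EWalk E a b → Σ (EWalk E a b) (λ w → Unique (vertsW w))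
  toPath nil = nil , ([] ∷ [])
  toPath (cons {x} s w) with toPath w
  ... | p , p-path with x ∈? vertsW p
  ...   | yes x∈p = pathSuffix p p-path x∈p
  ...   | no  x∉p = cons s p , (All.¬Any⇒All¬ (vertsW p) x∉p ∷ p-path)

  splitAt : ∀ {E a b x} (w : EWalk E a b) → x ∈ vertsW w →
    Σ (EWalk E a x) λ w₁ → Σ (EWalk E x b) λ w₂ → len w₁ + len w₂ ≡ len w
  splitAt nil        (here refl)  = nil , nil , refl
  splitAt (cons s w) (here refl)  = nil , cons s w , refl
  splitAt (cons s w) (there x∈w) with splitAt w x∈w
  ... | w₁ , w₂ , eq = cons s w₁ , w₂ , cong suc eq

  record FirstHit (E : List (V × V)) (Ps : List V) (c : V) (w-verts : List V) : Set where
    field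
      hit       : V
      hit∈Ps    : hit ∈ Ps
      prefix    : EWalk E c hit
      isPath    : Unique (vertsW prefix)
      leavesPs  : All (λ e → proj₁ e ∉ Ps) (edgesW prefix)
      within    : All (_∈ w-verts) (vertsW prefix)

  firstHit : ∀ {E c a} (Ps : List V) (w : EWalk E c a) → a ∈ Ps → Unique (vertsW w) →
    FirstHit E Ps c (vertsW w)
  firstHit Ps nil a∈Ps _ = record
    { hit = _ ; hit∈Ps = a∈Ps ; prefix = nil ; isPath = [] ∷ [] ; leavesPs = [] ; within = here refl ∷ [] }
  firstHit Ps (cons {c} s w) a∈Ps (c∉w ∷ w-path) with c ∈? Ps
  ... | yes c∈Ps = record
    { hit = c ; hit∈Ps = c∈Ps ; prefix = nil ; isPath = [] ∷ [] ; leavesPs = [] ; within = here refl ∷ [] }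
  ... | no  c∉Ps = record
    { hit = hit ; hit∈Ps = hit∈Ps ; prefix = cons s prefix
    ; isPath   = All.map (λ v∈w c≡v → All.lookup c∉w v∈w c≡v) within ∷ isPath
    ; leavesPs = c∉Ps ∷ leavesPs
    ; within   = here refl ∷ All.map there within
    }
    where open FirstHit (firstHit Ps w a∈Ps w-path)

  record Tripod (E : List (V × V)) (a b c : V) : Set where
    field
      centre : V
      toA    : EWalk E centre a
      toB    : EWalk E centre b
      toC    : EWalk E centre c
      total  : len toA + len toB + len toC ≤ length E

  -- Take a path P from a to b, and let Q be the part of a path from c
  -- until it first meets P, at x; then x is the centre.  The edges of Q
  -- and of P are pairwise distinct, so together they number at most |E|.
  tripod : ∀ {E a b c} → EWalk E a b → EWalk E c a → Tripod E a b c
  tripod {E} a→b c→a with toPath a→b | toPath c→a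
  ... | P , P-path | Q , Q-path with firstHit (vertsW P) Q (start∈vertsW P) Q-path
  ... | record { hit = x ; hit∈Ps = x∈P ; prefix = q ; isPath = q-path ; leavesPs = q-leaves }
    with splitAt P x∈P
  ... | x→a , x→b , split-len = record
    { centre = x ; toA = reverseW x→a ; toB = x→b ; toC = reverseW q ; total = total }
    where
      open ≤-Reasoning
      T : List (V × V)
      T = edgesW q ++ edgesW P
      T-distinct : Distinct T
      T-distinct = AllPairs.++⁺ (path-distinct q q-path) (path-distinct P P-path)
        (All.map (λ {e} e-leaves → All.map (leaving≉inside e _ e-leaves) (edgesW-ends P)) q-leaves)
      total : len (reverseW x→a) + len x→b + len (reverseW q) ≤ length E
      total = begin
        len (reverseW x→a) + len x→b + len (reverseW q)
          ≡⟨ cong₂ (λ i j → i + len x→b + j) (len-reverseW x→a) (len-reverseW q) ⟩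
        len x→a + len x→b + len q       ≡⟨ cong (_+ len q) split-len ⟩
        len P + len q                   ≡⟨ +-comm (len P) (len q) ⟩
        len q + len P                   ≡⟨ sym (cong₂ _+_ (length-edgesW q) (length-edgesW P)) ⟩
        length (edgesW q) + length (edgesW P) ≡⟨ sym (length-++ (edgesW q)) ⟩
        length T                        ≤⟨ distinct-length T-distinct (All.++⁺ (edgesW-∈ᴱ q) (edgesW-∈ᴱ P)) ⟩
        length E                        ∎

module GraphWalks {V : Set} {X : Graph V} where
  open Edges {V} using (Step)

  gedges : ∀ {s t} → GWalk X s t → List (V × V)
  gedges nil                = []
  gedges (cons {x} {y} _ w) = (x , y) ∷ gedges w

  _++g_ : ∀ {a b c} → GWalk X a b → GWalk X b c → GWalk X a c
  nil      ++g v = v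
  cons a w ++g v = cons a (w ++g v)

  length-gedges-++g : ∀ {a b c} (w : GWalk X a b) (v : GWalk X b c) →
    length (gedges (w ++g v)) ≡ length (gedges w) + length (gedges v)
  length-gedges-++g nil        v = refl
  length-gedges-++g (cons _ w) v = cong suc (length-gedges-++g w v)

  gedges-adj : ∀ {s t} (w : GWalk X s t) → All (λ e → Adj X (proj₁ e) (proj₂ e)) (gedges w)
  gedges-adj nil        = []
  gedges-adj (cons a w) = a ∷ gedges-adj w

  walkAlong : ∀ {E s t} (w : GWalk X s t) → gedges w ⊆ E → EWalk E s t
  walkAlong nil        _   = nil
  walkAlong (cons _ w) w⊆E = cons (inj₁ (w⊆E (here refl))) (walkAlong w (λ e∈w → w⊆E (there e∈w)))

  reachAlong : ∀ {E s t} (w : GWalk X s t) → gedges w ⊆ E →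
    All (λ e → EWalk E s (proj₁ e) × EWalk E s (proj₂ e)) (gedges w)
  reachAlong nil        _   = []
  reachAlong {E} {s} (cons {y = y} _ w) w⊆E =
    (nil , cons first nil) ∷ All.map (Product.map (cons first) (cons first)) (reachAlong w (λ e∈w → w⊆E (there e∈w)))
    where
      first : Step E s y
      first = inj₁ (w⊆E (here refl))

module Star {V : Set} (_≟_ : DecidableEquality V) (X : Graph V) (hub : V) where
  open Walks {V} using (_++w_; reverseW)
  open Dedup _≟_
  open GraphWalks {V} {X}

  Spoke : Set
  Spoke = Σ V (GWalk X hub)

  spokeEdges : List Spoke → List (V × V)
  spokeEdges []            = []
  spokeEdges ((_ , w) ∷ ws) = gedges w ++ spokeEdges ws

  totalLength : List Spoke → ℕ
  totalLength []            = zero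
  totalLength ((_ , w) ∷ ws) = length (gedges w) + totalLength ws

  length-spokeEdges : ∀ ws → length (spokeEdges ws) ≡ totalLength ws
  length-spokeEdges []            = refl
  length-spokeEdges ((_ , w) ∷ ws) =
    trans (length-++ (gedges w)) (cong (length (gedges w) +_) (length-spokeEdges ws))

  spokes-adj : ∀ ws → All (λ e → Adj X (proj₁ e) (proj₂ e)) (spokeEdges ws)
  spokes-adj []            = []
  spokes-adj ((_ , w) ∷ ws) = All.++⁺ (gedges-adj w) (spokes-adj ws)

  spokes-ends : ∀ {E} ws → spokeEdges ws ⊆ E → All (EWalk E hub) (map proj₁ ws)
  spokes-ends []            _    = []
  spokes-ends ((_ , w) ∷ ws) ws⊆E =
    walkAlong w (λ e∈w → ws⊆E (Any.++⁺ˡ e∈w)) ∷ spokes-ends ws (λ e∈ws → ws⊆E (Any.++⁺ʳ (gedges w) e∈ws))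

  spokes-reach : ∀ {E} ws → spokeEdges ws ⊆ E →
    All (λ e → EWalk E hub (proj₁ e) × EWalk E hub (proj₂ e)) (spokeEdges ws)
  spokes-reach []            _    = []
  spokes-reach ((_ , w) ∷ ws) ws⊆E =
    All.++⁺ (reachAlong w (λ e∈w → ws⊆E (Any.++⁺ˡ e∈w)))
            (spokes-reach ws (λ e∈ws → ws⊆E (Any.++⁺ʳ (gedges w) e∈ws)))

  starSubgraph : (ws : List Spoke) →
    Σ (ConnSubgraph X) λ F → Contains F (map proj₁ ws) × size F ≤ totalLength ws
  starSubgraph ws = F , All.map dedup-walk (spokes-ends ws (λ e∈ws → e∈ws)) , size-F
    where
      E : List (V × V)
      E = spokeEdges ws
      F : ConnSubgraph X
      F = record
        { Vs       = EWalk (dedup E) hub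
        ; edges    = dedup E
        ; edgesAdj = dedup-All (spokes-adj ws)
        ; edgesIn  = dedup-All (All.map (Product.map dedup-walk dedup-walk) (spokes-reach ws (λ e∈ws → e∈ws)))
        ; distinct = dedup-distinct E
        ; conn     = λ _ _ hub→x hub→y → reverseW hub→x ++w hub→y
        }
      size-F : size F ≤ totalLength ws
      size-F = ≤-trans (dedup-length E) (≤-reflexive (length-spokeEdges ws))

module CartesianProduct {V W : Set} (_≟V_ : DecidableEquality V) (_≟W_ : DecidableEquality W)
               (G : Graph V) (H : Graph W) where
  module DedupV = Dedup _≟V_
  module DedupW = Dedup _≟W_

  ProductEdges : List ((V × W) × (V × W)) → Set
  ProductEdges L = All (λ e → Adj (G □ H) (proj₁ e) (proj₂ e)) L

  gPart : (L : List ((V × W) × (V × W))) → ProductEdges L → List (V × V)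
  gPart []                           []             = []
  gPart (_ ∷ L)                      (inj₁ _ ∷ adj) = gPart L adj
  gPart (((g , _) , (g' , _)) ∷ L) (inj₂ _ ∷ adj) = (g , g') ∷ gPart L adj

  hPart : (L : List ((V × W) × (V × W))) → ProductEdges L → List (W × W)
  hPart []                           []             = []
  hPart (((_ , h) , (_ , h')) ∷ L) (inj₁ _ ∷ adj) = (h , h') ∷ hPart L adj
  hPart (_ ∷ L)                      (inj₂ _ ∷ adj) = hPart L adj

  length-parts : ∀ L (adj : ProductEdges L) → length (gPart L adj) + length (hPart L adj) ≡ length L
  length-parts []      []            = refl
  length-parts (_ ∷ L) (inj₁ _ ∷ adj) = trans (+-suc _ _) (cong suc (length-parts L adj))
  length-parts (_ ∷ L) (inj₂ _ ∷ adj) = cong suc (length-parts L adj)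

  gPart-adj : ∀ L (adj : ProductEdges L) → All (λ e → Adj G (proj₁ e) (proj₂ e)) (gPart L adj)
  gPart-adj []      []                 = []
  gPart-adj (_ ∷ L) (inj₁ _ ∷ adj)       = gPart-adj L adj
  gPart-adj (_ ∷ L) (inj₂ (_ , a) ∷ adj) = a ∷ gPart-adj L adj

  hPart-adj : ∀ L (adj : ProductEdges L) → All (λ e → Adj H (proj₁ e) (proj₂ e)) (hPart L adj)
  hPart-adj []      []                 = []
  hPart-adj (_ ∷ L) (inj₁ (_ , a) ∷ adj) = a ∷ hPart-adj L adj
  hPart-adj (_ ∷ L) (inj₂ _ ∷ adj)       = hPart-adj L adj

  gPart-ends : ∀ {Q : V × W → Set} L (adj : ProductEdges L) → All (λ e → Q (proj₁ e) × Q (proj₂ e)) L →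
    All (λ e → (Σ W λ h → Q (proj₁ e , h)) × (Σ W λ h → Q (proj₂ e , h))) (gPart L adj)
  gPart-ends []      []             []            = []
  gPart-ends (_ ∷ L) (inj₁ _ ∷ adj) (_ ∷ qs)       = gPart-ends L adj qs
  gPart-ends (((_ , h) , (_ , h')) ∷ L) (inj₂ _ ∷ adj) ((q , q') ∷ qs) = ((h , q) , (h' , q')) ∷ gPart-ends L adj qs

  hPart-ends : ∀ {Q : V × W → Set} L (adj : ProductEdges L) → All (λ e → Q (proj₁ e) × Q (proj₂ e)) L →
    All (λ e → (Σ V λ g → Q (g , proj₁ e)) × (Σ V λ g → Q (g , proj₂ e))) (hPart L adj)
  hPart-ends []      []             []            = []
  hPart-ends (((g , _) , (g' , _)) ∷ L) (inj₁ _ ∷ adj) ((q , q') ∷ qs) = ((g , q) , (g' , q')) ∷ hPart-ends L adj qs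
  hPart-ends (_ ∷ L) (inj₂ _ ∷ adj) (_ ∷ qs)       = hPart-ends L adj qs

  gPart-∈ : ∀ {g h g' h'} L (adj : ProductEdges L) → ((g , h) , (g' , h')) ∈ L → g ≡ g' ⊎ (g , g') ∈ gPart L adj
  gPart-∈ (_ ∷ L) (inj₁ (g≡g' , _) ∷ adj) (here refl) = inj₁ g≡g'
  gPart-∈ (_ ∷ L) (inj₂ _ ∷ adj)          (here refl) = inj₂ (here refl)
  gPart-∈ (_ ∷ L) (inj₁ _ ∷ adj)          (there e∈L) = gPart-∈ L adj e∈L
  gPart-∈ (_ ∷ L) (inj₂ _ ∷ adj)          (there e∈L) = Sum.map₂ there (gPart-∈ L adj e∈L)

  hPart-∈ : ∀ {g h g' h'} L (adj : ProductEdges L) → ((g , h) , (g' , h')) ∈ L → h ≡ h' ⊎ (h , h') ∈ hPart L adj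
  hPart-∈ (_ ∷ L) (inj₁ _ ∷ adj)          (here refl) = inj₂ (here refl)
  hPart-∈ (_ ∷ L) (inj₂ (h≡h' , _) ∷ adj) (here refl) = inj₁ h≡h'
  hPart-∈ (_ ∷ L) (inj₁ _ ∷ adj)          (there e∈L) = Sum.map₂ there (hPart-∈ L adj e∈L)
  hPart-∈ (_ ∷ L) (inj₂ _ ∷ adj)          (there e∈L) = hPart-∈ L adj e∈L

  gPart-walk : ∀ L (adj : ProductEdges L) {p q} → EWalk L p q → EWalk (gPart L adj) (proj₁ p) (proj₁ q)
  gPart-walk L adj nil = nil
  gPart-walk L adj (cons (inj₁ e∈L) w) with gPart-∈ L adj e∈L
  ... | inj₁ refl = gPart-walk L adj w
  ... | inj₂ e∈gL = cons (inj₁ e∈gL) (gPart-walk L adj w)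
  gPart-walk L adj (cons (inj₂ e∈L) w) with gPart-∈ L adj e∈L
  ... | inj₁ refl = gPart-walk L adj w
  ... | inj₂ e∈gL = cons (inj₂ e∈gL) (gPart-walk L adj w)

  hPart-walk : ∀ L (adj : ProductEdges L) {p q} → EWalk L p q → EWalk (hPart L adj) (proj₂ p) (proj₂ q)
  hPart-walk L adj nil = nil
  hPart-walk L adj (cons (inj₁ e∈L) w) with hPart-∈ L adj e∈L
  ... | inj₁ refl = hPart-walk L adj w
  ... | inj₂ e∈hL = cons (inj₁ e∈hL) (hPart-walk L adj w)
  hPart-walk L adj (cons (inj₂ e∈L) w) with hPart-∈ L adj e∈L
  ... | inj₁ refl = hPart-walk L adj w
  ... | inj₂ e∈hL = cons (inj₂ e∈hL) (hPart-walk L adj w)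

  projectG : ConnSubgraph (G □ H) → ConnSubgraph G
  projectG F = record
    { Vs       = λ g → Σ W λ h → Vs F (g , h)
    ; edges    = DedupV.dedup (gPart L adj)
    ; edgesAdj = DedupV.dedup-All (gPart-adj L adj)
    ; edgesIn  = DedupV.dedup-All (gPart-ends L adj (edgesIn F))
    ; distinct = DedupV.dedup-distinct (gPart L adj)
    ; conn     = λ { g g' (h , gh∈F) (h' , g'h'∈F) → DedupV.dedup-walk (gPart-walk L adj (conn F (g , h) (g' , h') gh∈F g'h'∈F)) }
    }
    where
      L : List ((V × W) × (V × W))
      L = edges F
      adj : ProductEdges L
      adj = edgesAdj F

  projectH : ConnSubgraph (G □ H) → ConnSubgraph H
  projectH F = record
    { Vs       = λ h → Σ V λ g → Vs F (g , h)
    ; edges    = DedupW.dedup (hPart L adj)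
    ; edgesAdj = DedupW.dedup-All (hPart-adj L adj)
    ; edgesIn  = DedupW.dedup-All (hPart-ends L adj (edgesIn F))
    ; distinct = DedupW.dedup-distinct (hPart L adj)
    ; conn     = λ { h h' (g , gh∈F) (g' , g'h'∈F) → DedupW.dedup-walk (hPart-walk L adj (conn F (g , h) (g' , h') gh∈F g'h'∈F)) }
    }
    where
      L : List ((V × W) × (V × W))
      L = edges F
      adj : ProductEdges L
      adj = edgesAdj F

  size-projections : ∀ F → size (projectG F) + size (projectH F) ≤ size F
  size-projections F = ≤-trans
    (+-mono-≤ (DedupV.dedup-length (gPart (edges F) (edgesAdj F))) (DedupW.dedup-length (hPart (edges F) (edgesAdj F))))
    (≤-reflexive (length-parts (edges F) (edgesAdj F)))

  lowerBound : ∀ (S : List (V × W)) {k₁ k₂} →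
    (∀ (FG : ConnSubgraph G) → Contains FG (map proj₁ S) → k₁ ≤ size FG) →
    (∀ (FH : ConnSubgraph H) → Contains FH (map proj₂ S) → k₂ ≤ size FH) →
    ∀ (F : ConnSubgraph (G □ H)) → Contains F S → k₁ + k₂ ≤ size F
  lowerBound S boundG boundH F F∋S = ≤-trans
    (+-mono-≤ (boundG (projectG F) (All.map⁺ (All.map (λ {p} p∈F → proj₂ p , p∈F) F∋S)))
              (boundH (projectH F) (All.map⁺ (All.map (λ {p} p∈F → proj₁ p , p∈F) F∋S))))
    (size-projections F)

  open Walks using (len)
  open GraphWalks {V × W} {G □ H}

  liftG : ∀ {E x x'} → All (λ e → Adj G (proj₁ e) (proj₂ e)) E → EWalk E x x' → (y : W) →
    GWalk (G □ H) (x , y) (x' , y)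
  liftG adj nil                  y = nil
  liftG adj (cons (inj₁ e∈E) w) y = cons (inj₂ (refl , All.lookup adj e∈E)) (liftG adj w y)
  liftG adj (cons (inj₂ e∈E) w) y = cons (inj₂ (refl , symAdj G (All.lookup adj e∈E))) (liftG adj w y)

  length-liftG : ∀ {E x x'} (adj : All (λ e → Adj G (proj₁ e) (proj₂ e)) E) (w : EWalk E x x') y →
    length (gedges (liftG adj w y)) ≡ len w
  length-liftG adj nil                y = refl
  length-liftG adj (cons (inj₁ _) w) y = cong suc (length-liftG adj w y)
  length-liftG adj (cons (inj₂ _) w) y = cong suc (length-liftG adj w y)

  liftH : ∀ {E y y'} → All (λ e → Adj H (proj₁ e) (proj₂ e)) E → (x : V) → EWalk E y y' →
    GWalk (G □ H) (x , y) (x , y')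
  liftH adj x nil                  = nil
  liftH adj x (cons (inj₁ e∈E) w) = cons (inj₁ (refl , All.lookup adj e∈E)) (liftH adj x w)
  liftH adj x (cons (inj₂ e∈E) w) = cons (inj₁ (refl , symAdj H (All.lookup adj e∈E))) (liftH adj x w)

  length-liftH : ∀ {E y y'} (adj : All (λ e → Adj H (proj₁ e) (proj₂ e)) E) x (w : EWalk E y y') →
    length (gedges (liftH adj x w)) ≡ len w
  length-liftH adj x nil                = refl
  length-liftH adj x (cons (inj₁ _) w) = cong suc (length-liftH adj x w)
  length-liftH adj x (cons (inj₂ _) w) = cong suc (length-liftH adj x w)

  corner : ∀ (FG : ConnSubgraph G) (FH : ConnSubgraph H) {x x' y y'} →
    EWalk (edges FG) x x' → EWalk (edges FH) y y' → GWalk (G □ H) (x , y) (x' , y')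
  corner FG FH {x' = x'} {y = y} wG wH = liftG (edgesAdj FG) wG y ++g liftH (edgesAdj FH) x' wH

  length-corner : ∀ (FG : ConnSubgraph G) (FH : ConnSubgraph H) {x x' y y'}
    (wG : EWalk (edges FG) x x') (wH : EWalk (edges FH) y y') →
    length (gedges (corner FG FH wG wH)) ≡ len wG + len wH
  length-corner FG FH {x' = x'} {y = y} wG wH = begin
    length (gedges (liftG (edgesAdj FG) wG y ++g liftH (edgesAdj FH) x' wH))
      ≡⟨ length-gedges-++g (liftG (edgesAdj FG) wG y) _ ⟩
    length (gedges (liftG (edgesAdj FG) wG y)) + length (gedges (liftH (edgesAdj FH) x' wH))
      ≡⟨ cong₂ _+_ (length-liftG (edgesAdj FG) wG y) (length-liftH (edgesAdj FH) x' wH) ⟩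
    len wG + len wH ∎
    where open ≡-Reasoning

  regroup : ∀ a₁ b₁ a₂ b₂ a₃ b₃ → (a₁ + b₁) + ((a₂ + b₂) + ((a₃ + b₃) + 0)) ≡ (a₁ + a₂ + a₃) + (b₁ + b₂ + b₃)
  regroup = solve 6 (λ a₁ b₁ a₂ b₂ a₃ b₃ →
    (a₁ :+ b₁) :+ ((a₂ :+ b₂) :+ ((a₃ :+ b₃) :+ con 0)) := (a₁ :+ a₂ :+ a₃) :+ (b₁ :+ b₂ :+ b₃)) refl
    where open +-*-Solver

  upperBound : ∀ {g g' g'' h h' h''} (FG : ConnSubgraph G) (FH : ConnSubgraph H) →
    Contains FG (g ∷ g' ∷ g'' ∷ []) → Contains FH (h ∷ h' ∷ h'' ∷ []) →
    Σ (ConnSubgraph (G □ H)) λ F →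
      Contains F ((g , h) ∷ (g' , h') ∷ (g'' , h'') ∷ []) × size F ≤ size FG + size FH
  upperBound {g} {g'} {g''} {h} {h'} {h''} FG FH (g∈ ∷ g'∈ ∷ g''∈ ∷ []) (h∈ ∷ h'∈ ∷ h''∈ ∷ []) =
    Product.map₂ (Product.map₂ (λ size-F → ≤-trans size-F spokes-bound)) (starSubgraph spokes)
    where
      open Paths.Tripod
      TG : Paths.Tripod _≟V_ (edges FG) g g' g''
      TG = Paths.tripod _≟V_ (conn FG _ _ g∈ g'∈) (conn FG _ _ g''∈ g∈)
      TH : Paths.Tripod _≟W_ (edges FH) h h' h''
      TH = Paths.tripod _≟W_ (conn FH _ _ h∈ h'∈) (conn FH _ _ h''∈ h∈)
      open Star (≡-dec _≟V_ _≟W_) (G □ H) (centre TG , centre TH)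
      spokes : List Spoke
      spokes = (_ , corner FG FH (toA TG) (toA TH)) ∷ (_ , corner FG FH (toB TG) (toB TH))
             ∷ (_ , corner FG FH (toC TG) (toC TH)) ∷ []
      spokes-bound : totalLength spokes ≤ size FG + size FH
      spokes-bound = begin
        totalLength spokes
          ≡⟨ cong₂ _+_ (length-corner FG FH (toA TG) (toA TH))
               (cong₂ _+_ (length-corner FG FH (toB TG) (toB TH))
                 (cong (_+ 0) (length-corner FG FH (toC TG) (toC TH)))) ⟩
        (len (toA TG) + len (toA TH)) + ((len (toB TG) + len (toB TH)) + ((len (toC TG) + len (toC TH)) + 0))
          ≡⟨ regroup (len (toA TG)) (len (toA TH)) (len (toB TG)) (len (toB TH)) (len (toC TG)) (len (toC TH)) ⟩
        (len (toA TG) + len (toB TG) + len (toC TG)) + (len (toA TH) + len (toB TH) + len (toC TH))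
          ≤⟨ +-mono-≤ (total TG) (total TH) ⟩
        size FG + size FH ∎
        where open ≤-Reasoning

corollary2p2 : (n m : ℕ) (G : Graph (Fin n)) (H : Graph (Fin m))
    → Connected G → Connected H
    → (g g' g'' : Fin n) (h h' h'' : Fin m)
    → ¬ ((g , h) ≡ (g' , h')) → ¬ ((g , h) ≡ (g'' , h'')) → ¬ ((g' , h') ≡ (g'' , h''))
    → (k₁ k₂ : ℕ)
    → SteinerDist G (g ∷ g' ∷ g'' ∷ []) k₁
    → SteinerDist H (h ∷ h' ∷ h'' ∷ []) k₂
    → SteinerDist (G □ H) ((g , h) ∷ (g' , h') ∷ (g'' , h'') ∷ []) (k₁ + k₂)
-- The minimum k₁ + k₂ is attained by the upper-bound construction and
-- bounds every competitor by the lower bound.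
corollary2p2 n m G H _ _ g g' g'' h h' h'' _ _ _ _ _
  ((FG , FG∋SG , refl) , minimalG) ((FH , FH∋SH , refl) , minimalH)
  with CartesianProduct.upperBound Fin._≟_ Fin._≟_ G H FG FH FG∋SG FH∋SH
... | F , F∋S , size-F = (F , F∋S , ≤-antisym size-F (minimal F F∋S)) , minimal
  where
    S : List (Fin n × Fin m)
    S = (g , h) ∷ (g' , h') ∷ (g'' , h'') ∷ []
    minimal : ∀ (F' : ConnSubgraph (G □ H)) → Contains F' S → size FG + size FH ≤ size F'
    minimal = CartesianProduct.lowerBound Fin._≟_ Fin._≟_ G H S minimalG minimalH
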